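{- Let $K,M_1,M_2,N$ be ordered partial commutative monoids and let $g_i\colon K\to M_i$ and $f_i\colon M_i\to N$ ($i=1,2$) be changes of domain, with upper adjoints $g_i^*,f_i^*$, such that $f_1(g_1(k))\cong f_2(g_2(k))$ for every $k\in K$ (a linking passage). Then for every $x\in M_1$, \[g_2\bigl(g_1^*(x)\bigr)\preceq f_2^*\bigl(f_1(x)\bigr).\]
   Context: An ordered partial commutative monoid (OPCM) $(M,\preceq,\oplus,0)$ consists of a preorder $\preceq$ on a set $M$, an element $0\in M$, and a partial binary operation $\oplus$ on $M$. Write $x\perp y$ when $x\oplus y$ is defined, and $x\cong y$ when $x\preceq y$ and $y\preceq x$. The axioms are: (OPCM1) $0\oplus x$ is defined and $0\oplus x\cong x$; (OPCM2) if $x\perp y$ then $y\perp x$ and $x\oplus y\cong y\oplus x$; (OPCM3) if $y\perp z$ and $x\perp(y\oplus z)$ then $x\perp y$, $(x\oplus y)\perp z$ and $x\oplus(y\oplus z)\cong(x\oplus y)\oplus z$; (OPCM4) if $x_1\preceq x_2$, $x_1\perp y$ and $x_2\perp y$ then $x_1\oplus y\preceq x_2\oplus y$. A homomorphism $f\colon M\to N$ of OPCMs is a function with: $x\preceq_M y\Rightarrow fx\preceq_N fy$; $f(0_M)\cong 0_N$; $x\perp y\Rightarrow f(x\oplus_M y)\cong fx\oplus_N fy$. A change of domain is a homomorphism $f\colon M\to N$ for which there exists an order-preserving map $f^*\colon N\to M$ (its upper adjoint) with $fx\preceq_N y\iff x\preceq_M f^*y$. -}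

module Defs where

open import Level using (Level; _⊔_; suc)
open import Data.Product using (Σ; _×_; _,_)
open import Function.Bundles using (_⇔_)

-- An ordered partial commutative monoid. The partial operation is modelled
-- by a definedness relation _⊥_ together with an operation that takes a
-- proof of definedness.
record OPCM (a ℓ d : Level) : Set (suc (a ⊔ ℓ ⊔ d)) where
  field
    Carrier : Set a
    _≼_     : Carrier → Carrier → Set ℓ
    _⊥_     : Carrier → Carrier → Set d
    op      : (x y : Carrier) → x ⊥ y → Carrier
    𝟘       : Carrier
    ≼-refl  : ∀ {x} → x ≼ x
    ≼-trans : ∀ {x y z} → x ≼ y → y ≼ z → x ≼ z

  _≅_ : Carrier → Carrier → Set ℓ
  x ≅ y = (x ≼ y) × (y ≼ x)

  field
    𝟘⊥      : ∀ x → 𝟘 ⊥ x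
    𝟘-unit  : ∀ x → op 𝟘 x (𝟘⊥ x) ≅ x
    ⊥-sym   : ∀ {x y} → x ⊥ y → y ⊥ x
    comm    : ∀ {x y} (p : x ⊥ y) → op x y p ≅ op y x (⊥-sym p)
    assoc⊥₁ : ∀ {x y z} (p : y ⊥ z) → x ⊥ op y z p → x ⊥ y
    assoc⊥₂ : ∀ {x y z} (p : y ⊥ z) (q : x ⊥ op y z p) → op x y (assoc⊥₁ p q) ⊥ z
    assoc   : ∀ {x y z} (p : y ⊥ z) (q : x ⊥ op y z p) →
              op x (op y z p) q ≅ op (op x y (assoc⊥₁ p q)) z (assoc⊥₂ p q)
    mono    : ∀ {x₁ x₂ y} → x₁ ≼ x₂ → (p : x₁ ⊥ y) (q : x₂ ⊥ y) → op x₁ y p ≼ op x₂ y q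

open OPCM public using (Carrier)

module _ {a ℓ d b m e : Level} (M : OPCM a ℓ d) (N : OPCM b m e) where
  private
    module M = OPCM M
    module N = OPCM N

  -- Homomorphism of OPCMs. The condition f(x ⊕ y) ≅ fx ⊕ fy includes that
  -- fx ⊕ fy is defined.
  record IsHom (f : M.Carrier → N.Carrier) : Set (a ⊔ ℓ ⊔ d ⊔ b ⊔ m ⊔ e) where
    field
      monotone : ∀ {x y} → x M.≼ y → f x N.≼ f y
      pres-𝟘   : f M.𝟘 N.≅ N.𝟘
      pres-⊥   : ∀ {x y} → x M.⊥ y → f x N.⊥ f y
      pres-⊕   : ∀ {x y} (p : x M.⊥ y) → f (M.op x y p) N.≅ N.op (f x) (f y) (pres-⊥ p)

  record IsUpperAdjoint (f : M.Carrier → N.Carrier) (f* : N.Carrier → M.Carrier)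
      : Set (a ⊔ ℓ ⊔ b ⊔ m) where
    field
      monotone* : ∀ {x y} → x N.≼ y → f* x M.≼ f* y
      adjunction : ∀ x y → (f x N.≼ y) ⇔ (x M.≼ f* y)

  record IsChangeOfDomainWith (f : M.Carrier → N.Carrier) (f* : N.Carrier → M.Carrier)
      : Set (a ⊔ ℓ ⊔ d ⊔ b ⊔ m ⊔ e) where
    field
      isHom : IsHom f
      isUpperAdjoint : IsUpperAdjoint f f*

module Submission where

-- For a change of domain f : M → N with upper adjoint f*, the
-- adjunction  f x ≼ y ⇔ x ≼ f* y  yields the counit  f (f* y) ≼ y.  To show
-- g₂ (g₁* x) ≼ f₂* (f₁ x)  it suffices, by the adjunction for f₂, to show
--   f₂ (g₂ (g₁* x)) ≼ f₁ x.
-- Put k = g₁* x.  The linking passage gives  f₂ (g₂ k) ≼ f₁ (g₁ k),  and the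
-- counit of g₁, g₁ k ≼ x, transported along the monotone map f₁ gives
-- f₁ (g₁ k) ≼ f₁ x.  Transitivity in N finishes the proof.

open import Defs
open import Level using (Level)
open import Data.Product using (proj₂)
open import Function.Bundles using (Equivalence)

module ChangeOfDomain {a ℓ d b m e : Level} {M : OPCM a ℓ d} {N : OPCM b m e}
    {f : Carrier M → Carrier N} {f* : Carrier N → Carrier M}
    (cod : IsChangeOfDomainWith M N f f*) where
  private
    module M = OPCM M
    module N = OPCM N
    open IsChangeOfDomainWith cod
    open IsUpperAdjoint isUpperAdjoint using (adjunction)

  monotone : ∀ {x y} → x M.≼ y → f x N.≼ f y
  monotone = IsHom.monotone isHom

  transpose : ∀ {x y} → f x N.≼ y → x M.≼ f* y
  transpose = Equivalence.to (adjunction _ _)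

  counit : ∀ y → f (f* y) N.≼ y
  counit y = Equivalence.from (adjunction (f* y) y) M.≼-refl

mainTheorem8 : ∀ {a₁ ℓ₁ d₁ a₂ ℓ₂ d₂ a₃ ℓ₃ d₃ a₄ ℓ₄ d₄ : Level}
    (K : OPCM a₁ ℓ₁ d₁) (M₁ : OPCM a₂ ℓ₂ d₂) (M₂ : OPCM a₃ ℓ₃ d₃) (N : OPCM a₄ ℓ₄ d₄)
    (g₁ : Carrier K → Carrier M₁) (g₁* : Carrier M₁ → Carrier K)
    (g₂ : Carrier K → Carrier M₂) (g₂* : Carrier M₂ → Carrier K)
    (f₁ : Carrier M₁ → Carrier N) (f₁* : Carrier N → Carrier M₁)
    (f₂ : Carrier M₂ → Carrier N) (f₂* : Carrier N → Carrier M₂) →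
    IsChangeOfDomainWith K M₁ g₁ g₁* →
    IsChangeOfDomainWith K M₂ g₂ g₂* →
    IsChangeOfDomainWith M₁ N f₁ f₁* →
    IsChangeOfDomainWith M₂ N f₂ f₂* →
    (∀ k → OPCM._≅_ N (f₁ (g₁ k)) (f₂ (g₂ k))) →
    ∀ x → OPCM._≼_ M₂ (g₂ (g₁* x)) (f₂* (f₁ x))
mainTheorem8 K M₁ M₂ N g₁ g₁* g₂ g₂* f₁ f₁* f₂ f₂* cg₁ cg₂ cf₁ cf₂ link x =
  ChangeOfDomain.transpose cf₂ (OPCM.≼-trans N linked pushedCounit)
  where
    linked : OPCM._≼_ N (f₂ (g₂ (g₁* x))) (f₁ (g₁ (g₁* x)))
    linked = proj₂ (link (g₁* x))

    pushedCounit : OPCM._≼_ N (f₁ (g₁ (g₁* x))) (f₁ x)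
    pushedCounit = ChangeOfDomain.monotone cf₁ (ChangeOfDomain.counit cg₁ x)
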